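{- For any forward trie $\mathsf{T}_{\mathsf{f}}$ with $n\ge 3$ nodes over an alphabet of size $\sigma$, $\mathsf{CDAWG}(\mathsf{T}_{\mathsf{f}})$ has at most $2n-3$ nodes and $O(\sigma n)$ edges. Moreover, there exist forward tries $\mathsf{T}_{\mathsf{f}}$ with $n$ nodes over an alphabet of size $\sigma$ (for $\sigma$ ranging from $\Theta(1)$ to $\Theta(n)$) such that $\mathsf{CDAWG}(\mathsf{T}_{\mathsf{f}})$ has $\Omega(\sigma n)$ edges; in particular $\Omega(n^2)$ edges when $\sigma=\Theta(n)$.
   Context: Let $\Sigma$ be an ordered alphabet. A forward trie $\mathsf{T}_{\mathsf{f}}$ is a rooted tree with edges labeled by single characters of $\Sigma$, the out-going edges of each node having distinct labels. For $u$ an ancestor of $v$, $\mathit{str}_{\mathsf{f}}(u,v)$ is the string spelled by the downward path from $u$ to $v$; $\mathit{Substr}(\mathsf{T}_{\mathsf{f}})$ is the set of these strings. $X\in\mathit{Substr}(\mathsf{T}_{\mathsf{f}})$ is right-maximal if there are distinct $a,b\in\Sigma$ with $Xa,Xb\in\mathit{Substr}(\mathsf{T}_{\mathsf{f}})$ or $X=\mathit{str}_{\mathsf{f}}(u,l)$ with $l$ a leaf; left-maximal if there are distinct $a,b$ with $aX,bX\in\mathit{Substr}(\mathsf{T}_{\mathsf{f}})$ or $X=\mathit{str}_{\mathsf{f}}(r,v)$ with $r$ the root; maximal if both. $\mathit{mxml}_{\mathsf{f}}(X)$ is the shortest maximal string of the form $\alpha X\beta$. $\mathsf{CDAWG}(\mathsf{T}_{\mathsf{f}})$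 has one node per equivalence class of $\mathit{Substr}(\mathsf{T}_{\mathsf{f}})$ under $X\equiv X'$ iff $\mathit{mxml}_{\mathsf{f}}(X)=\mathit{mxml}_{\mathsf{f}}(X')$ (each class having a longest member, a maximal string $Z$); for each node with longest member $Z$ and each $a\in\Sigma$ with $Za\in\mathit{Substr}(\mathsf{T}_{\mathsf{f}})$ there is one edge, labeled $a\beta$, to the class of $Za$, where $\mathit{mxml}_{\mathsf{f}}(Za)=\alpha Za\beta$. Equivalently, it is obtained from the DAWG of $\mathsf{T}_{\mathsf{f}}$ by contracting non-branching paths. Convention: the root of the trie is connected to an auxiliary node $\bot$ by an edge labeled by a unique character $\$$ occurring nowhere else. -}

module Defs where

open import Data.Nat using (ℕ; zero; suc; _≤_; _<_)
open import Data.Fin using (Fin; zero; suc; toℕ)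
open import Data.List using (List; []; _∷_; _∷ʳ_; _++_; length)
open import Data.List.Relation.Unary.All using (All)
open import Data.List.Relation.Unary.AllPairs using (AllPairs)
open import Data.Product using (Σ; ∃; ∃-syntax; _×_; _,_)
open import Data.Sum using (_⊎_)
open import Relation.Nullary using (¬_)
open import Relation.Binary.PropositionalEquality using (_≡_; _≢_)
open import Function.Bundles using (_⇔_)

-- A trie  Trie σ m  has  suc m  nodes, namely  Fin (suc m);  the root is
-- zero, and the non-root nodes are  suc i  for  i : Fin m.  Node  suc i
-- has parent  parent i  and the edge (parent i) → (suc i) is labelled by
-- label i ∈ Σ = Fin σ.  Nodes are numbered so that every parent has a
-- smaller number than its child (any rooted tree admits such a
-- numbering, e.g. BFS order); this guarantees the parent pointers form
-- a tree rooted at zero.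

record Trie (σ m : ℕ) : Set where
  field
    parent      : Fin m → Fin (suc m)
    label       : Fin m → Fin σ
    parent<     : ∀ i → toℕ (parent i) < toℕ (suc i)
    deterministic : ∀ i j → parent i ≡ parent j → label i ≡ label j → i ≡ j

module _ {σ m : ℕ} (T : Trie σ m) where
  open Trie T

  Node : Set
  Node = Fin (suc m)

  Str : Set
  Str = List (Fin σ)

  root : Node
  root = zero

  -- Path u v w : u is an ancestor of v (or u = v) and str_f(u,v) = w.
  data Path (u : Node) : Node → Str → Set where
    here : Path u u []
    step : ∀ {i w} → Path u (parent i) w → Path u (suc i) (w ∷ʳ label i)

  Leaf : Node → Set
  Leaf v = ∀ i → parent i ≢ v

  Substr : Str → Set
  Substr X = ∃[ u ] ∃[ v ] Path u v X

  RightMaximal : Str → Set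
  RightMaximal X =
    Substr X ×
    ((∃[ a ] ∃[ b ] (a ≢ b × Substr (X ∷ʳ a) × Substr (X ∷ʳ b)))
     ⊎ (∃[ u ] ∃[ l ] (Leaf l × Path u l X)))

  LeftMaximal : Str → Set
  LeftMaximal X =
    Substr X ×
    ((∃[ a ] ∃[ b ] (a ≢ b × Substr (a ∷ X) × Substr (b ∷ X)))
     ⊎ (∃[ v ] Path root v X))

  Maximal : Str → Set
  Maximal X = RightMaximal X × LeftMaximal X

  IsMxml : Str → Str → Set
  IsMxml X Y =
    Maximal Y ×
    (∃[ α ] ∃[ β ] (Y ≡ α ++ X ++ β)) ×
    (∀ α β → Maximal (α ++ X ++ β) → length Y ≤ length (α ++ X ++ β))

  -- X ≡ X'  iff  mxml_f(X) = mxml_f(X')  (stated as: they have the same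
  -- shortest maximal extensions).
  _≈ₘ_ : Str → Str → Set
  X ≈ₘ X' = ∀ Y → IsMxml X Y ⇔ IsMxml X' Y

  -- Nodes of CDAWG(T): equivalence classes of Substr(T) under ≈ₘ.
  -- "CDAWG(T) has at least k nodes" is witnessed by k substrings that are
  -- pairwise non-equivalent (i.e. lie in k distinct classes).
  DistinctNodes : List Str → Set
  DistinctNodes Xs = All Substr Xs × AllPairs (λ X X' → ¬ (X ≈ₘ X')) Xs

  LongestInClass : Str → Set
  LongestInClass Z = Substr Z × (∀ X → Substr X → X ≈ₘ Z → length X ≤ length Z)

  -- Edges of CDAWG(T): one edge for each node (class with longest member Z)
  -- and each a ∈ Σ with Za ∈ Substr(T).  An edge is represented by the pair
  -- (Z , a).
  IsEdge : Str × Fin σ → Set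
  IsEdge (Z , a) = LongestInClass Z × Substr (Z ∷ʳ a)

  SameEdge : Str × Fin σ → Str × Fin σ → Set
  SameEdge (Z , a) (Z' , a') = Z ≈ₘ Z' × a ≡ a'

  DistinctEdges : List (Str × Fin σ) → Set
  DistinctEdges Es = All IsEdge Es × AllPairs (λ e e' → ¬ SameEdge e e') Es

-- Prepending the unique left context of a string that is not
-- left-maximal does not change its ≈ₘ-class, so every class contains a
-- left-maximal string L.  Such an L is anchored at a trie node: at the node it
-- spells from the root, or, if L is left-branching but not a root path, at the
-- node where the canonical leftward extension of bL reaches a root path, for a
-- letter b other than the canonical left letter of L.  Anchoring is injective,
-- so the CDAWG has at most 2n nodes and at most 2nσ edges; when the empty
-- string is left-branching, three anchors of the second kind are never used,
-- giving 2n - 3.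
--
-- Lower bound.  In a broom, a path of k edges labelled 0 whose end has one
-- child per letter, every 0^l with l ≤ k is maximal and is followed by every
-- letter, which gives (k + 1)σ ≥ σn/2 edges.

module Submission where

open import Defs
open import Data.Nat using (ℕ; zero; suc; _≤_; _*_; _∸_)
open import Data.List using (List; length)
open import Data.Fin using (Fin)
open import Data.Product using (Σ; ∃; ∃-syntax; _×_; _,_)

open import Data.Nat using (_+_; _<_; _≤?_; z≤n; s≤s; ⌊_/2⌋; ⌈_/2⌉)
open import Data.Nat.Properties
  using ( module ≤-Reasoning; ≤-refl; ≤-reflexive; ≤-trans; ≤-antisym; ≤-total; <⇒≤; ≤-<-trans; <-irrefl
        ; ≰⇒>; <⇒≱; n≤1+n; m≤m+n; m≤n+m; +-comm; +-suc; +-identityʳ; +-monoˡ-≤; +-monoʳ-≤; +-cancelʳ-≤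
        ; *-assoc; *-comm; *-monoˡ-≤; *-monoʳ-≤; m+[n∸m]≡n; m∸n+n≡m; m+n≤o⇒m≤o∸n
        ; ⌊n/2⌋-mono; ⌊n/2⌋≤n; ⌊n/2⌋≤⌈n/2⌉; ⌊n/2⌋+⌈n/2⌉≡n )
open import Data.Fin
  using (zero; suc; toℕ; _≟_; _↑ˡ_; _↑ʳ_; fromℕ; inject₁; splitAt; join; remQuot)
  renaming (_<_ to _<ᶠ_)
open import Data.Fin.Induction using (<-weakInduction)
open import Data.Fin.Properties
  using ( pigeonhole; any?; +↔⊎; *↔×; toℕ≤pred[n]; toℕ<n; toℕ-injective; toℕ-↑ˡ; toℕ-↑ʳ; toℕ-fromℕ
        ; toℕ-inject₁; inject₁-injective; fromℕ≢inject₁; splitAt-↑ˡ; splitAt-↑ʳ; join-splitAt )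
open import Data.List using ([]; _∷_; _∷ʳ_; _++_; [_]; lookup; tabulate; replicate)
open import Data.List.Properties
  using (length-++; length-replicate; length-tabulate; ++-identityʳ; ++-assoc; ∷-injective; ∷ʳ-injective; ∷ʳ-++)
open import Data.List.Reverse using (Reverse; []; _∶_∶ʳ_; reverseView)
open import Data.List.Membership.Propositional.Properties using (∈-lookup)
open import Data.List.Relation.Unary.All using (All; []; _∷_)
import Data.List.Relation.Unary.All as All
import Data.List.Relation.Unary.All.Properties as All
open import Data.List.Relation.Unary.AllPairs using (AllPairs; []; _∷_)
import Data.List.Relation.Unary.AllPairs.Properties as AllPairs
import Data.List.Relation.Unary.Unique.Propositional.Properties as Unique
open import Data.Maybe using (Maybe; just; nothing)
import Data.Maybe as Maybe
open import Data.Maybe.Properties using (just-injective)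
import Data.Maybe.Properties as Maybe
open import Data.Product using (∃₂; proj₁; proj₂)
open import Data.Product.Function.NonDependent.Propositional using (_×-↔_)
open import Data.Sum using (_⊎_; inj₁; inj₂)
open import Data.Sum.Properties using (inj₂-injective)
open import Data.Empty using (⊥-elim)
open import Function using (_∘_; case_of_)
open import Function.Bundles using (_↣_; Injection; _⇔_; mk⇔; Equivalence)
import Function.Properties.Equivalence as ⇔
open import Function.Properties.Inverse using (↔-refl; ↔-sym; ↔-trans; ↔⇒↣)
open import Relation.Nullary using (¬_; Dec; yes; no; contradiction)
open import Relation.Nullary.Decidable using (map′; _×-dec_; _⊎-dec_; ¬?; dec⇒maybe)
open import Relation.Binary.PropositionalEquality
  using (_≡_; _≢_; refl; sym; trans; cong; subst; subst₂; module ≡-Reasoning)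

∷ʳ≢[] : ∀ {A : Set} (xs : List A) {x} → xs ∷ʳ x ≢ []
∷ʳ≢[] []      ()
∷ʳ≢[] (_ ∷ _) ()

length-∷ʳ : ∀ {A : Set} (xs : List A) {x} → length (xs ∷ʳ x) ≡ suc (length xs)
length-∷ʳ xs = trans (length-++ xs) (+-comm (length xs) 1)

length-infix : ∀ {A : Set} (xs ys zs : List A) → length ys ≤ length (xs ++ ys ++ zs)
length-infix xs ys zs = subst (length ys ≤_) (sym (trans (length-++ xs) (cong (length xs +_) (length-++ ys))))
  (≤-trans (m≤m+n (length ys) (length zs)) (m≤n+m _ (length xs)))

replicate-∷ʳ : ∀ {A : Set} n (x : A) → replicate n x ∷ʳ x ≡ replicate (suc n) x
replicate-∷ʳ zero    x = refl
replicate-∷ʳ (suc n) x = cong (x ∷_) (replicate-∷ʳ n x)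

replicate-++ : ∀ {A : Set} m n (x : A) → replicate (m + n) x ≡ replicate m x ++ replicate n x
replicate-++ zero    n x = refl
replicate-++ (suc m) n x = cong (x ∷_) (replicate-++ m n x)

2*n≡n+n : ∀ n → 2 * n ≡ n + n
2*n≡n+n n = cong (n +_) (+-identityʳ n)

AllPairs-lookup : ∀ {A : Set} {R : A → A → Set} {xs : List A} → AllPairs R xs →
                  ∀ {i j} → i <ᶠ j → R (lookup xs i) (lookup xs j)
AllPairs-lookup (r ∷ _)  {zero}  {suc j} _         = All.lookup r (∈-lookup j)
AllPairs-lookup (_ ∷ rs) {suc i} {suc j} (s≤s i<j) = AllPairs-lookup rs i<j

distinct-length≤ : ∀ {B : Set} {n} → B ↣ Fin n → {bs : List B} → AllPairs _≢_ bs → length bs ≤ n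
distinct-length≤ {n = n} enc {bs} distinct with length bs ≤? n
... | yes bs≤n = bs≤n
... | no bs≰n with pigeonhole (≰⇒> bs≰n) (Injection.to enc ∘ lookup bs)
... | i , j , i<j , same = contradiction (Injection.injective enc same) (AllPairs-lookup distinct i<j)

module _ {A B : Set} {R : A → B → Set} where

  choices : ∀ {xs} → All (λ x → ∃ (R x)) xs → List B
  choices []             = []
  choices ((b , _) ∷ rs) = b ∷ choices rs

  length-choices : ∀ {xs} (rs : All (λ x → ∃ (R x)) xs) → length (choices rs) ≡ length xs
  length-choices []       = refl
  length-choices (_ ∷ rs) = cong suc (length-choices rs)

  choices-All : ∀ {Q : B → Set} → (∀ {x b} → R x b → Q b) →
                ∀ {xs} (rs : All (λ x → ∃ (R x)) xs) → All Q (choices rs)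
  choices-All q []             = []
  choices-All q ((_ , r) ∷ rs) = q r ∷ choices-All q rs

  module _ {D : A → A → Set} (separates : ∀ {x y b} → R x b → R y b → ¬ D x y) where

    choices-avoid : ∀ {x b xs} → R x b → All (D x) xs →
                    (rs : All (λ y → ∃ (R y)) xs) → All (b ≢_) (choices rs)
    choices-avoid r []       []              = []
    choices-avoid r (d ∷ ds) ((_ , r′) ∷ rs) = (λ { refl → separates r r′ d }) ∷ choices-avoid r ds rs

    choices-distinct : ∀ {xs} (rs : All (λ x → ∃ (R x)) xs) → AllPairs D xs → AllPairs _≢_ (choices rs)
    choices-distinct []             []       = []
    choices-distinct ((_ , r) ∷ rs) (d ∷ ds) = choices-avoid r d rs ∷ choices-distinct rs ds

    separated-length≤ : ∀ {n xs} → B ↣ Fin n → (rs : All (λ x → ∃ (R x)) xs) → AllPairs D xs →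
                        (avoid : List B) → AllPairs _≢_ avoid → (∀ {x b} → R x b → All (b ≢_) avoid) →
                        length xs + length avoid ≤ n
    separated-length≤ enc rs ds avoid avoid-distinct avoided =
      subst (_≤ _) (trans (length-++ (choices rs)) (cong (_+ length avoid) (length-choices rs)))
        (distinct-length≤ enc (AllPairs.++⁺ (choices-distinct rs ds) avoid-distinct (choices-All avoided rs)))

module TrieFacts {σ m : ℕ} (T : Trie σ m) where
  open Trie T

  path-≤ : ∀ {u v w} → Path T u v w → toℕ u ≤ toℕ v
  path-≤ here         = ≤-refl
  path-≤ (step {i} p) = ≤-trans (path-≤ p) (<⇒≤ (parent< i))

  length-path : ∀ {u v w} → Path T u v w → length w ≤ toℕ v
  length-path here             = z≤n
  length-path (step {i} {w} p) = subst (_≤ toℕ (suc i)) (sym (length-∷ʳ w)) (≤-<-trans (length-path p) (parent< i))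

  length-substr : ∀ {w} → Substr T w → length w ≤ m
  length-substr (_ , v , p) = ≤-trans (length-path p) (toℕ≤pred[n] v)

  path-++ : ∀ {u t v w w′} → Path T u t w → Path T t v w′ → Path T u v (w ++ w′)
  path-++ {w = w} p here              = subst (Path T _ _) (sym (++-identityʳ w)) p
  path-++ {w = w} p (step {i} {w′} q) = subst (Path T _ _) (++-assoc w w′ [ label i ]) (step (path-++ p q))

  path-[]⁻ : ∀ {u v} → Path T u v [] → u ≡ v
  path-[]⁻ p = go p refl
    where
    go : ∀ {u v w} → Path T u v w → w ≡ [] → u ≡ v
    go here                 _ = refl
    go (step {w = w} _) e = contradiction e (∷ʳ≢[] w)

  path-∷ʳ⁻ : ∀ {u v w a} → Path T u v (w ∷ʳ a) →
             ∃ λ i → v ≡ suc i × label i ≡ a × Path T u (parent i) w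
  path-∷ʳ⁻ p = go p refl
    where
    go : ∀ {u v w′ w a} → Path T u v w′ → w′ ≡ w ∷ʳ a →
         ∃ λ i → v ≡ suc i × label i ≡ a × Path T u (parent i) w
    go here                     e = contradiction (sym e) (∷ʳ≢[] _)
    go (step {i} {w = w′} p) e with ∷ʳ-injective w′ _ e
    ... | refl , refl = i , refl , refl , p

  path-edge : ∀ {u t w a} i → parent i ≡ t → label i ≡ a → Path T u t w → Path T u (suc i) (w ∷ʳ a)
  path-edge i refl refl = step

  path-split : ∀ {u v} w {w′} → Reverse w′ → Path T u v (w ++ w′) → ∃ λ t → Path T u t w × Path T t v w′
  path-split w [] p = _ , subst (Path T _ _) (++-identityʳ w) p , here
  path-split w (w′ ∶ r ∶ʳ a) p with path-∷ʳ⁻ (subst (Path T _ _) (sym (++-assoc w w′ [ a ])) p)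
  ... | i , refl , refl , q with path-split w r q
  ... | t , q₁ , q₂ = t , q₁ , step q₂

  path-unique : ∀ {u v w w′} → Path T u v w → Path T u v w′ → w ≡ w′
  path-unique here         here          = refl
  path-unique here         (step {i} q)  = ⊥-elim (<-irrefl refl (≤-<-trans (path-≤ q) (parent< i)))
  path-unique (step {i} p) here          = ⊥-elim (<-irrefl refl (≤-<-trans (path-≤ p) (parent< i)))
  path-unique (step p)     (step q)      = cong (_∷ʳ _) (path-unique p q)

  path-replicate-prefix : ∀ {u v n a} l → l ≤ n → Path T u v (replicate n a) → ∃ λ t → Path T u t (replicate l a)
  path-replicate-prefix {n = n} {a} l l≤n p
    with path-split (replicate l a) (reverseView _)
           (subst (Path T _ _)
             (trans (cong (λ n → replicate n a) (sym (m+[n∸m]≡n l≤n))) (replicate-++ l (n ∸ l) a)) p)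
  ... | t , p₁ , _ = t , p₁

  path-replicate-suffix : ∀ {u v n a} l → l ≤ n → Path T u v (replicate n a) → ∃ λ t → Path T t v (replicate l a)
  path-replicate-suffix {n = n} {a} l l≤n p
    with path-split (replicate (n ∸ l) a) (reverseView _)
           (subst (Path T _ _)
             (trans (cong (λ n → replicate n a) (sym (m∸n+n≡m l≤n))) (replicate-++ (n ∸ l) l a)) p)
  ... | t , _ , p₂ = t , p₂

  path? : ∀ u {w} → Reverse w → ∀ v → Dec (Path T u v w)
  path? u []            v       = map′ (λ { refl → here }) path-[]⁻ (u ≟ v)
  path? u (w ∶ r ∶ʳ a)  zero    = no λ p → case path-∷ʳ⁻ p of λ { (_ , () , _) }
  path? u (w ∶ r ∶ʳ a)  (suc i) =
    map′ (λ (ℓ , p) → path-edge i refl ℓ p) inversion (label i ≟ a ×-dec path? u r (parent i))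
    where
    inversion : Path T u (suc i) (w ∷ʳ a) → label i ≡ a × Path T u (parent i) w
    inversion p with path-∷ʳ⁻ p
    ... | _ , refl , ℓ , q = ℓ , q

  path-to-root : ∀ {u w} → Path T u zero w → w ≡ []
  path-to-root here = refl

  substr? : ∀ w → Dec (Substr T w)
  substr? w = any? λ u → any? λ v → path? u (reverseView w) v

  substr-prefix : ∀ X {β} → Substr T (X ++ β) → Substr T X
  substr-prefix X (u , _ , p) with path-split X (reverseView _) p
  ... | t , p₁ , _ = u , t , p₁

  substr-suffix : ∀ α {X} → Substr T (α ++ X) → Substr T X
  substr-suffix α (_ , v , p) with path-split α (reverseView _) p
  ... | t , _ , p₂ = t , v , p₂

  substr-infix : ∀ α X {β} → Substr T (α ++ X ++ β) → Substr T X
  substr-infix α X s = substr-prefix X (substr-suffix α s)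

  FromRoot : Str T → Set
  FromRoot X = ∃ λ v → Path T (root T) v X

  fromRoot? : ∀ X → Dec (FromRoot X)
  fromRoot? X = any? λ v → path? zero (reverseView X) v

  LeftBranching : Str T → Set
  LeftBranching X = ∃₂ λ a b → a ≢ b × Substr T (a ∷ X) × Substr T (b ∷ X)

  leftBranching? : ∀ X → Dec (LeftBranching X)
  leftBranching? X = any? λ a → any? λ b → ¬? (a ≟ b) ×-dec substr? (a ∷ X) ×-dec substr? (b ∷ X)

  leftMaximal? : ∀ X → Dec (LeftMaximal T X)
  leftMaximal? X = substr? X ×-dec (leftBranching? X ⊎-dec fromRoot? X)

  leftBranching-prefix : ∀ X {β} → LeftBranching (X ++ β) → LeftBranching X
  leftBranching-prefix X (a , b , a≢b , sa , sb) = a , b , a≢b , substr-prefix (a ∷ X) sa , substr-prefix (b ∷ X) sb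

  leftMaximal-prefix : ∀ X {β} → LeftMaximal T (X ++ β) → LeftMaximal T X
  leftMaximal-prefix X (s , inj₁ br) = substr-prefix X s , inj₁ (leftBranching-prefix X br)
  leftMaximal-prefix X (s , inj₂ (_ , p)) with path-split X (reverseView _) p
  ... | t , p₁ , _ = substr-prefix X s , inj₂ (t , p₁)

  LeftExtensible : Str T → Set
  LeftExtensible X = ∃ λ a → Substr T (a ∷ X)

  leftExtensible? : ∀ X → Dec (LeftExtensible X)
  leftExtensible? X = any? λ a → substr? (a ∷ X)

  nonLeftExtensible⇒fromRoot : ∀ {X} → Substr T X → ¬ LeftExtensible X → FromRoot X
  nonLeftExtensible⇒fromRoot (zero  , v , p) _   = v , p
  nonLeftExtensible⇒fromRoot (suc i , v , p) ¬ext = contradiction (label i , parent i , v , path-++ (step here) p) ¬ext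

  leftInduction : (P : Str T → Set) →
                  (∀ X → Substr T X → (∀ a → Substr T (a ∷ X) → P (a ∷ X)) → P X) →
                  ∀ X → Substr T X → P X
  leftInduction P extend X s = go (suc m) X s (s≤s (m≤m+n m (length X)))
    where
    go : ∀ k X → Substr T X → m < k + length X → P X
    go zero    X s m<X   = contradiction (length-substr s) (<⇒≱ m<X)
    go (suc k) X s m<k+X = extend X s λ a sa → go k (a ∷ X) sa (subst (m <_) (sym (+-suc k (length X))) m<k+X)

  -- The classes of ≈ₘ and their left-maximal members

  infix 4 _≈_
  _≈_ : Str T → Str T → Set
  _≈_ = _≈ₘ_ T

  ≈-refl : ∀ {X} → X ≈ X
  ≈-refl _ = ⇔.refl

  ≈-sym : ∀ {X X′} → X ≈ X′ → X′ ≈ X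
  ≈-sym X≈X′ Y = ⇔.sym (X≈X′ Y)

  ≈-trans : ∀ {X X′ X″} → X ≈ X′ → X′ ≈ X″ → X ≈ X″
  ≈-trans X≈X′ X′≈X″ Y = ⇔.trans (X≈X′ Y) (X′≈X″ Y)

  Occurs : Str T → Str T → Set
  Occurs X Y = ∃₂ λ α β → Y ≡ α ++ X ++ β

  sameMaximalOccurrences⇒≈ : ∀ {X X′} → (∀ Y → Maximal T Y → Occurs X Y ⇔ Occurs X′ Y) → X ≈ X′
  sameMaximalOccurrences⇒≈ same Y = mk⇔ (transfer same) (transfer (λ Y mY → ⇔.sym (same Y mY)))
    where
    transfer : ∀ {X X′} → (∀ Y → Maximal T Y → Occurs X Y ⇔ Occurs X′ Y) → IsMxml T X Y → IsMxml T X′ Y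
    transfer same (mY , occ , shortest) = mY , Equivalence.to (same Y mY) occ , λ α β mZ →
      let α′ , β′ , e = Equivalence.from (same _ mZ) (α , β , refl)
      in subst (λ Z → length Y ≤ length Z) (sym e) (shortest α′ β′ (subst (Maximal T) e mZ))

  leftExtension-≈ : ∀ {X} → Substr T X → ¬ LeftMaximal T X → ∃ λ a → Substr T (a ∷ X) × X ≈ a ∷ X
  leftExtension-≈ (zero , v , p) ¬lm = contradiction ((zero , v , p) , inj₂ (v , p)) ¬lm
  leftExtension-≈ {X} s@(suc i , v , p) ¬lm =
    label i , sa , sameMaximalOccurrences⇒≈ λ Y mY → mk⇔ (extend Y mY) shrink
    where
    sa : Substr T (label i ∷ X)
    sa = parent i , v , path-++ (step here) p

    extend : ∀ Y → Maximal T Y → Occurs X Y → Occurs (label i ∷ X) Y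
    extend Y mY (α , β , e) = go (reverseView α) e
      where
      go : ∀ {α} → Reverse α → Y ≡ α ++ X ++ β → Occurs (label i ∷ X) Y
      go [] e = contradiction (leftMaximal-prefix X (subst (LeftMaximal T) e (proj₂ mY))) ¬lm
      go (α′ ∶ _ ∶ʳ c) e with c ≟ label i
      ... | yes refl = α′ , β , trans e (∷ʳ-++ α′ c (X ++ β))
      ... | no c≢a   = contradiction (s , inj₁ (c , label i , c≢a , sc , sa)) ¬lm
        where
        sc : Substr T (c ∷ X)
        sc = substr-infix α′ (c ∷ X) (subst (Substr T) (trans e (∷ʳ-++ α′ c (X ++ β))) (proj₁ (proj₁ mY)))

    shrink : ∀ {Y} → Occurs (label i ∷ X) Y → Occurs X Y
    shrink (α , β , e) = α ∷ʳ label i , β , trans e (sym (∷ʳ-++ α (label i) (X ++ β)))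

  leftMaximal-representative : ∀ X → Substr T X → ∃ λ L → LeftMaximal T L × X ≈ L
  leftMaximal-representative = leftInduction _ extend
    where
    extend : ∀ X → Substr T X → (∀ a → Substr T (a ∷ X) → ∃ λ L → LeftMaximal T L × a ∷ X ≈ L) →
            ∃ λ L → LeftMaximal T L × X ≈ L
    extend X s ih with leftMaximal? X
    ... | yes lm  = X , lm , ≈-refl
    ... | no ¬lm with leftExtension-≈ s ¬lm
    ... | a , sa , X≈aX with ih a sa
    ... | L , lm , aX≈L = L , lm , ≈-trans X≈aX aX≈L

  maximal⇒mxml-self : ∀ {Z} → Maximal T Z → IsMxml T Z Z
  maximal⇒mxml-self {Z} mZ = mZ , ([] , [] , sym (++-identityʳ Z)) , λ α β _ → length-infix α Z β

  maximal⇒longestInClass : ∀ {Z} → Maximal T Z → LongestInClass T Z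
  maximal⇒longestInClass mZ = proj₁ (proj₁ mZ) , λ X _ X≈Z →
    let _ , (α , β , e) , _ = Equivalence.from (X≈Z _) (maximal⇒mxml-self mZ)
    in subst (λ W → length X ≤ length W) (sym e) (length-infix α X β)

  maximal-≈⇒length≤ : ∀ {Z Z′} → Maximal T Z → Maximal T Z′ → Z ≈ Z′ → length Z ≤ length Z′
  maximal-≈⇒length≤ {Z} {Z′} mZ mZ′ Z≈Z′ =
    let _ , _ , shortest = Equivalence.to (Z≈Z′ Z) (maximal⇒mxml-self mZ)
    in subst (length Z ≤_) (cong length (++-identityʳ Z′))
         (shortest [] [] (subst (Maximal T) (sym (++-identityʳ Z′)) mZ′))

  maximal-≈⇒length≡ : ∀ {Z Z′} → Maximal T Z → Maximal T Z′ → Z ≈ Z′ → length Z ≡ length Z′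
  maximal-≈⇒length≡ mZ mZ′ Z≈Z′ =
    ≤-antisym (maximal-≈⇒length≤ mZ mZ′ Z≈Z′) (maximal-≈⇒length≤ mZ′ mZ (≈-sym Z≈Z′))

  -- Canonical left chains and anchors

  leftLetter : Str T → Maybe (Fin σ)
  leftLetter X = Maybe.map proj₁ (dec⇒maybe (leftExtensible? X))

  leftLetter-just : ∀ {X a} → leftLetter X ≡ just a → Substr T (a ∷ X)
  leftLetter-just {X} e with leftExtensible? X | e
  ... | yes (_ , s) | refl = s
  ... | no _        | ()

  leftLetter-nothing : ∀ {X} → leftLetter X ≡ nothing → ¬ LeftExtensible X
  leftLetter-nothing {X} e with leftExtensible? X | e
  ... | no ¬ext | refl = ¬ext
  ... | yes _   | ()

  leftExtensible⇒leftLetter : ∀ {X} → LeftExtensible X → ∃ λ a → leftLetter X ≡ just a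
  leftExtensible⇒leftLetter {X} ext with leftLetter X in e
  ... | just a  = a , refl
  ... | nothing = contradiction ext (leftLetter-nothing e)

  -- Y ◁ W: W arises from Y by repeatedly prepending leftLetter.  As leftLetter
  -- is a function of the string, chains inside one W are comparable (◁-linear).
  infix 4 _◁_
  data _◁_ (Y : Str T) : Str T → Set where
    ◁-refl : Y ◁ Y
    ◁-step : ∀ {Z a} → Y ◁ Z → leftLetter Z ≡ just a → Y ◁ a ∷ Z

  ◁-length : ∀ {Y W} → Y ◁ W → length Y ≤ length W
  ◁-length ◁-refl       = ≤-refl
  ◁-length (◁-step c _) = ≤-trans (◁-length c) (n≤1+n _)

  ◁-linear : ∀ {Y Y′ W} → Y ◁ W → Y′ ◁ W → length Y ≤ length Y′ → Y ◁ Y′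
  ◁-linear c            ◁-refl        _    = c
  ◁-linear ◁-refl       (◁-step c′ _) Y≤Y′ = contradiction (≤-trans Y≤Y′ (◁-length c′)) (<-irrefl refl)
  ◁-linear (◁-step c _) (◁-step c′ _) Y≤Y′ = ◁-linear c c′ Y≤Y′

  ChainEnd : Fin σ → Str T → Node T → Set
  ChainEnd b L v = ∃ λ W → b ∷ L ◁ W × Path T (root T) v W

  chainEnd-exists : ∀ {b L} → Substr T (b ∷ L) → ∃ (ChainEnd b L)
  chainEnd-exists {b} {L} s = leftInduction P extend (b ∷ L) s ◁-refl
    where
    P : Str T → Set
    P Z = b ∷ L ◁ Z → ∃ (ChainEnd b L)

    extend : ∀ Z → Substr T Z → (∀ a → Substr T (a ∷ Z) → P (a ∷ Z)) → P Z
    extend Z sZ ih c with leftLetter Z in e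
    ... | just a  = ih a (leftLetter-just e) (◁-step c e)
    ... | nothing = let v , p = nonLeftExtensible⇒fromRoot sZ (leftLetter-nothing e) in v , Z , c , p

  chainEnd-separates : ∀ {b b′ L L′ v} → ChainEnd b L v → ChainEnd b′ L′ v → leftLetter L′ ≢ just b′ →
                       length L ≤ length L′ → b ∷ L ≡ b′ ∷ L′
  chainEnd-separates (W , c , p) (W′ , c′ , p′) b′≢leftL′ L≤L′
    with ◁-linear c (subst (_ ◁_) (path-unique p′ p) c′) (s≤s L≤L′)
  ... | ◁-refl       = refl
  ... | ◁-step _ leftL′ = contradiction leftL′ b′≢leftL′

  chainEnd-nonRoot : ∀ {b L v} → ChainEnd b L v → v ≢ root T
  chainEnd-nonRoot (_ , c , p) refl with path-to-root p
  chainEnd-nonRoot (_ , c , p) refl | refl = contradiction (◁-length c) λ ()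

  otherLetter : ∀ {L} → LeftBranching L → ∃ λ b → leftLetter L ≢ just b × Substr T (b ∷ L)
  otherLetter {L} (a , a′ , a≢a′ , sa , sa′) with Maybe.≡-dec _≟_ (leftLetter L) (just a)
  ... | yes leftL≡a = a′ , (λ leftL≡a′ → a≢a′ (just-injective (trans (sym leftL≡a) leftL≡a′))) , sa′
  ... | no  leftL≢a = a , leftL≢a , sa

  -- Since b is not the canonical left letter of L, the chain from bL leaves
  -- the chain from L; this makes chained anchors injective (chainEnd-separates).
  data Anchor (L : Str T) : Node T ⊎ Node T → Set where
    rooted  : ∀ {v} → Path T (root T) v L → Anchor L (inj₁ v)
    chained : ∀ {b v} → ¬ FromRoot L → LeftBranching L → leftLetter L ≢ just b → ChainEnd b L v →
              Anchor L (inj₂ v)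

  anchor-exists : ∀ {L} → LeftMaximal T L → ∃ (Anchor L)
  anchor-exists {L} (_ , br) with fromRoot? L
  ... | yes (v , p) = inj₁ v , rooted p
  ... | no ¬r with br
  ... | inj₂ r  = contradiction r ¬r
  ... | inj₁ lb with otherLetter lb
  ... | b , leftL≢b , sb with chainEnd-exists sb
  ... | v , ch = inj₂ v , chained ¬r lb leftL≢b ch

  anchor-injective : ∀ {L L′ e} → Anchor L e → Anchor L′ e → L ≡ L′
  anchor-injective (rooted p) (rooted p′) = path-unique p p′
  anchor-injective {L} {L′} (chained _ _ leftL≢b ch) (chained _ _ leftL′≢b′ ch′)
    with ≤-total (length L) (length L′)
  ... | inj₁ L≤L′ = proj₂ (∷-injective (chainEnd-separates ch ch′ leftL′≢b′ L≤L′))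
  ... | inj₂ L′≤L = sym (proj₂ (∷-injective (chainEnd-separates ch′ ch leftL≢b L′≤L)))

  -- The upper bounds

  ClassAnchor : Str T → Node T ⊎ Node T → Set
  ClassAnchor X e = ∃ λ L → X ≈ L × Anchor L e

  classAnchor-exists : ∀ {X} → Substr T X → ∃ (ClassAnchor X)
  classAnchor-exists {X} s with leftMaximal-representative X s
  ... | L , lm , X≈L with anchor-exists lm
  ... | e , a = e , L , X≈L , a

  classAnchor-separates : ∀ {X X′ e} → ClassAnchor X e → ClassAnchor X′ e → X ≈ X′
  classAnchor-separates (L , X≈L , a) (L′ , X′≈L′ , a′) with anchor-injective a a′
  ... | refl = ≈-trans X≈L (≈-sym X′≈L′)

  Anchor↣Fin : (Node T ⊎ Node T) ↣ Fin (suc m + suc m)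
  Anchor↣Fin = ↔⇒↣ (↔-sym (+↔⊎ {suc m} {suc m}))

  module _ {Xs : List (Str T)} (distinct : DistinctNodes T Xs) where

    classAnchors-length≤ : (avoid : List (Node T ⊎ Node T)) → AllPairs _≢_ avoid →
                           (∀ {X e} → ClassAnchor X e → All (e ≢_) avoid) →
                           length Xs + length avoid ≤ suc m + suc m
    classAnchors-length≤ = separated-length≤ (λ a a′ X≉X′ → X≉X′ (classAnchor-separates a a′))
                             Anchor↣Fin (All.map classAnchor-exists (proj₁ distinct)) (proj₂ distinct)

    nodes-unbranched : ¬ LeftBranching [] → length Xs ≤ suc m
    nodes-unbranched ¬br = +-cancelʳ-≤ (suc m) _ _
      (subst (λ k → length Xs + k ≤ suc m + suc m) (length-tabulate inj₂)
        (classAnchors-length≤ (tabulate inj₂) (Unique.tabulate⁺ inj₂-injective) rooted-only))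
      where
      rooted-only : ∀ {X e} → ClassAnchor X e → All (e ≢_) (tabulate inj₂)
      rooted-only (_ , _ , rooted _) = All.tabulate⁺ {f = inj₂} λ _ ()
      rooted-only (L , _ , chained _ lb _ _) = contradiction (leftBranching-prefix [] lb) ¬br

    -- A chained anchor comes from some L ≠ [] and a letter b ≠ leftLetter L, so it
    -- is never the root nor the end of the chain from a one-letter word.
    nodes-branched : LeftBranching [] → length Xs + 3 ≤ suc m + suc m
    nodes-branched br@(a , _ , _ , sa , _) with leftExtensible⇒leftLetter (a , sa) | otherLetter br
    ... | d₀ , left[]≡d₀ | b₀ , left[]≢b₀ , sb₀
        with chainEnd-exists (leftLetter-just left[]≡d₀) | chainEnd-exists sb₀
    ... | v₀ , ch₀ | v₁ , ch₁ =
          classAnchors-length≤ (inj₂ (root T) ∷ inj₂ v₀ ∷ inj₂ v₁ ∷ []) unusedSlots-distinct unusedSlots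
      where
      v₀≢v₁ : v₀ ≢ v₁
      v₀≢v₁ refl = left[]≢b₀ (subst (λ c → leftLetter [] ≡ just c)
                     (proj₁ (∷-injective (chainEnd-separates ch₀ ch₁ left[]≢b₀ ≤-refl))) left[]≡d₀)

      unusedSlots-distinct : AllPairs _≢_ (inj₂ (root T) ∷ inj₂ v₀ ∷ inj₂ v₁ ∷ [])
      unusedSlots-distinct = ( (chainEnd-nonRoot ch₀ ∘ sym ∘ inj₂-injective)
                             ∷ (chainEnd-nonRoot ch₁ ∘ sym ∘ inj₂-injective) ∷ [])
                      ∷ ((v₀≢v₁ ∘ inj₂-injective) ∷ []) ∷ [] ∷ []

      unusedSlots : ∀ {X e} → ClassAnchor X e → All (e ≢_) (inj₂ (root T) ∷ inj₂ v₀ ∷ inj₂ v₁ ∷ [])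
      unusedSlots (_ , _ , rooted _) = (λ ()) ∷ (λ ()) ∷ (λ ()) ∷ []
      unusedSlots {e = inj₂ v} (L , _ , chained ¬r _ leftL≢b ch) =
        (chainEnd-nonRoot ch ∘ inj₂-injective) ∷ apart ch₀ ∷ apart ch₁ ∷ []
        where
        apart : ∀ {c w} → ChainEnd c [] w → inj₂ v ≢ inj₂ w
        apart chw e with inj₂-injective e
        ... | refl = ¬r (root T , subst (Path T (root T) (root T))
                                     (proj₂ (∷-injective (chainEnd-separates chw ch leftL≢b z≤n))) here)

  nodes-bound : 3 ≤ suc m → ∀ Xs → DistinctNodes T Xs → length Xs ≤ 2 * suc m ∸ 3
  nodes-bound 3≤n Xs distinct with leftBranching? []
  ... | no ¬br = ≤-trans (nodes-unbranched distinct ¬br)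
                   (m+n≤o⇒m≤o∸n (suc m) (subst (suc m + 3 ≤_) (sym (2*n≡n+n (suc m))) (+-monoʳ-≤ (suc m) 3≤n)))
  ... | yes br = m+n≤o⇒m≤o∸n (length Xs)
                   (subst (length Xs + 3 ≤_) (sym (2*n≡n+n (suc m))) (nodes-branched distinct br))

  EdgeAnchor : Str T × Fin σ → (Node T ⊎ Node T) × Fin σ → Set
  EdgeAnchor (Z , a) (e , a′) = ClassAnchor Z e × a ≡ a′

  edgeAnchor-exists : ∀ {E} → IsEdge T E → ∃ (EdgeAnchor E)
  edgeAnchor-exists {Z , a} ((sZ , _) , _) with classAnchor-exists sZ
  ... | e , ca = (e , a) , ca , refl

  edgeAnchor-separates : ∀ {E E′ x} → EdgeAnchor E x → EdgeAnchor E′ x → ¬ ¬ SameEdge T E E′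
  edgeAnchor-separates (ca , refl) (ca′ , refl) ¬same = ¬same (classAnchor-separates ca ca′ , refl)

  EdgeAnchor↣Fin : ((Node T ⊎ Node T) × Fin σ) ↣ Fin ((suc m + suc m) * σ)
  EdgeAnchor↣Fin = ↔⇒↣ (↔-sym (↔-trans (*↔× {suc m + suc m} {σ}) (+↔⊎ ×-↔ ↔-refl)))

  edges-bound : ∀ Es → DistinctEdges T Es → length Es ≤ 2 * σ * suc m
  edges-bound Es (edges , distinct) = subst₂ _≤_ (+-identityʳ (length Es)) count
    (separated-length≤ edgeAnchor-separates EdgeAnchor↣Fin (All.map edgeAnchor-exists edges) distinct [] [] (λ _ → []))
    where
    open ≡-Reasoning
    count : (suc m + suc m) * σ ≡ 2 * σ * suc m
    count = begin
      (suc m + suc m) * σ ≡⟨ cong (_* σ) (sym (2*n≡n+n (suc m))) ⟩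
      2 * suc m * σ       ≡⟨ *-assoc 2 (suc m) σ ⟩
      2 * (suc m * σ)     ≡⟨ cong (2 *_) (*-comm (suc m) σ) ⟩
      2 * (σ * suc m)     ≡⟨ *-assoc 2 σ (suc m) ⟨
      2 * σ * suc m       ∎

-- The broom and the lower bounds

module Broom (k s : ℕ) where

  -- handle j is the node at depth j on the path labelled 0, hub = handle k, and
  -- bristle c is the child of the hub labelled c.
  handle : Fin (suc k) → Fin (suc (k + suc s))
  handle zero    = zero
  handle (suc j) = suc (j ↑ˡ suc s)

  hub : Fin (suc (k + suc s))
  hub = handle (fromℕ k)

  bristle : Fin (suc s) → Fin (suc (k + suc s))
  bristle c = suc (k ↑ʳ c)

  parentOf : Fin k ⊎ Fin (suc s) → Fin (suc (k + suc s))
  parentOf (inj₁ j) = handle (inject₁ j)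
  parentOf (inj₂ _) = hub

  labelOf : Fin k ⊎ Fin (suc s) → Fin (suc s)
  labelOf (inj₁ _) = zero
  labelOf (inj₂ c) = c

  toℕ-handle : ∀ j → toℕ (handle j) ≡ toℕ j
  toℕ-handle zero    = refl
  toℕ-handle (suc j) = cong suc (toℕ-↑ˡ j (suc s))

  toℕ-hub : toℕ hub ≡ k
  toℕ-hub = trans (toℕ-handle (fromℕ k)) (toℕ-fromℕ k)

  handle-injective : ∀ {i j} → handle i ≡ handle j → i ≡ j
  handle-injective {i} {j} e = toℕ-injective (trans (sym (toℕ-handle i)) (trans (cong toℕ e) (toℕ-handle j)))

  parentOf-≤ : ∀ x → toℕ (parentOf x) ≤ toℕ (join k (suc s) x)
  parentOf-≤ (inj₁ j) =
    ≤-reflexive (trans (toℕ-handle (inject₁ j)) (trans (toℕ-inject₁ j) (sym (toℕ-↑ˡ j (suc s)))))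
  parentOf-≤ (inj₂ c) = subst₂ _≤_ (sym toℕ-hub) (sym (toℕ-↑ʳ k c)) (m≤m+n k (toℕ c))

  parentOf-≤-hub : ∀ x → toℕ (parentOf x) ≤ toℕ hub
  parentOf-≤-hub (inj₁ j) =
    subst₂ _≤_ (sym (trans (toℕ-handle (inject₁ j)) (toℕ-inject₁ j))) (sym toℕ-hub) (<⇒≤ (toℕ<n j))
  parentOf-≤-hub (inj₂ _) = ≤-refl

  parentOf-labelOf-injective : ∀ x y → parentOf x ≡ parentOf y → labelOf x ≡ labelOf y → x ≡ y
  parentOf-labelOf-injective (inj₁ i) (inj₁ j) e _ = cong inj₁ (inject₁-injective (handle-injective e))
  parentOf-labelOf-injective (inj₁ i) (inj₂ _) e _ = contradiction (sym (handle-injective e)) fromℕ≢inject₁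
  parentOf-labelOf-injective (inj₂ _) (inj₁ j) e _ = contradiction (handle-injective e) fromℕ≢inject₁
  parentOf-labelOf-injective (inj₂ _) (inj₂ _) _ e = cong inj₂ e

  parentOf-< : ∀ i → toℕ (parentOf (splitAt k i)) < toℕ (suc {k + suc s} i)
  parentOf-< i = s≤s (subst (toℕ (parentOf (splitAt k i)) ≤_) (cong toℕ (join-splitAt k (suc s) i))
                        (parentOf-≤ (splitAt k i)))

  splitAt-injective : ∀ i j → splitAt k {suc s} i ≡ splitAt k j → i ≡ j
  splitAt-injective i j e =
    trans (sym (join-splitAt k (suc s) i)) (trans (cong (join k (suc s)) e) (join-splitAt k (suc s) j))

  broom : Trie (suc s) (k + suc s)
  broom = record
    { parent        = parentOf ∘ splitAt k
    ; label         = labelOf ∘ splitAt k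
    ; parent<       = parentOf-<
    ; deterministic = λ i j pe le →
                        splitAt-injective i j (parentOf-labelOf-injective (splitAt k i) (splitAt k j) pe le)
    }

  open TrieFacts broom

  rep : ℕ → List (Fin (suc s))
  rep n = replicate n zero

  handle-path : ∀ j → Path broom zero (handle j) (rep (toℕ j))
  handle-path = <-weakInduction (λ j → Path broom zero (handle j) (rep (toℕ j))) here λ j p →
    subst (Path broom zero (handle (suc j)))
      (trans (cong (λ n → rep n ∷ʳ zero) (toℕ-inject₁ j)) (replicate-∷ʳ (toℕ j) zero))
      (path-edge (j ↑ˡ suc s) (cong parentOf (splitAt-↑ˡ k j (suc s))) (cong labelOf (splitAt-↑ˡ k j (suc s))) p)

  hub-path : Path broom zero hub (rep k)
  hub-path = subst (λ n → Path broom zero hub (rep n)) (toℕ-fromℕ k) (handle-path (fromℕ k))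

  bristle-edge : ∀ {u w} c → Path broom u hub w → Path broom u (bristle c) (w ∷ʳ c)
  bristle-edge c = path-edge (k ↑ʳ c) (cong parentOf (splitAt-↑ʳ k (suc s) c)) (cong labelOf (splitAt-↑ʳ k (suc s) c))

  leaf : Node broom
  leaf = bristle zero

  leaf-isLeaf : Leaf broom leaf
  leaf-isLeaf i e = <⇒≱ (s≤s (subst₂ _≤_ (sym toℕ-hub) (sym (toℕ-↑ʳ k zero)) (m≤m+n k 0)))
                        (subst (λ v → toℕ v ≤ toℕ hub) e (parentOf-≤-hub (splitAt k i)))

  leaf-path : Path broom zero leaf (rep (suc k))
  leaf-path = subst (Path broom zero leaf) (replicate-∷ʳ k zero) (bristle-edge zero hub-path)

  rep-maximal : ∀ {l} → l ≤ k → Maximal broom (rep l)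
  rep-maximal {l} l≤k
    with path-replicate-prefix l l≤k hub-path | path-replicate-suffix l (≤-trans l≤k (n≤1+n k)) leaf-path
  ... | t , from-root | u , to-leaf = ((zero , t , from-root) , inj₂ (u , leaf , leaf-isLeaf , to-leaf))
                                    , (zero , t , from-root) , inj₂ (t , from-root)

  rep∷ʳ-substr : ∀ {l} c → l ≤ k → Substr broom (rep l ∷ʳ c)
  rep∷ʳ-substr {l} c l≤k with path-replicate-suffix l l≤k hub-path
  ... | u , to-hub = u , bristle c , bristle-edge c to-hub

  edge : Fin (suc k) × Fin (suc s) → Str broom × Fin (suc s)
  edge (l , c) = rep (toℕ l) , c

  edge-isEdge : ∀ x → IsEdge broom (edge x)
  edge-isEdge (l , c) = maximal⇒longestInClass (rep-maximal (toℕ≤pred[n] l)) , rep∷ʳ-substr c (toℕ≤pred[n] l)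

  edge-injective : ∀ x y → SameEdge broom (edge x) (edge y) → x ≡ y
  edge-injective (l , c) (l′ , c′) (l≈l′ , refl) = cong (_, c) (toℕ-injective
    (subst₂ _≡_ (length-replicate (toℕ l)) (length-replicate (toℕ l′))
      (maximal-≈⇒length≡ (rep-maximal (toℕ≤pred[n] l)) (rep-maximal (toℕ≤pred[n] l′)) l≈l′)))

  edges : List (Str broom × Fin (suc s))
  edges = tabulate (edge ∘ remQuot (suc s))

  edges-distinct : DistinctEdges broom edges
  edges-distinct = All.tabulate⁺ (edge-isEdge ∘ remQuot (suc s))
                 , AllPairs.tabulate⁺ λ i≢j same →
                     i≢j (Injection.injective (↔⇒↣ (*↔× {suc k} {suc s})) (edge-injective _ _ same))

  length-edges : length edges ≡ suc k * suc s
  length-edges = length-tabulate (edge ∘ remQuot (suc s))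

2[1+s]≤1+m⇒1+s≤m : ∀ s {m} → 2 * suc s ≤ suc m → suc s ≤ m
2[1+s]≤1+m⇒1+s≤m s {m} 2σ≤n with s≤s s+σ≤m ← subst (_≤ suc m) (2*n≡n+n (suc s)) 2σ≤n = ≤-trans (m≤n+m (suc s) s) s+σ≤m

broom-lowerBound : ∀ σ m → 1 ≤ σ → 2 * σ ≤ suc m →
                   Σ (Trie σ m) λ T → ∃[ Es ] (DistinctEdges T Es × σ * suc m ≤ 2 * length Es)
broom-lowerBound (suc s) m _ 2σ≤n with m ∸ suc s | m∸n+n≡m (2[1+s]≤1+m⇒1+s≤m s 2σ≤n)
... | k | refl = broom , edges , edges-distinct , subst (λ e → suc s * suc (k + suc s) ≤ 2 * e) (sym length-edges) bound
  where
  open Broom k s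
  open ≤-Reasoning

  σ≤k+1 : suc s ≤ suc k
  σ≤k+1 = +-cancelʳ-≤ (suc s) (suc s) (suc k) (subst (_≤ suc k + suc s) (2*n≡n+n (suc s)) 2σ≤n)

  bound : suc s * (suc k + suc s) ≤ 2 * (suc k * suc s)
  bound = begin
    suc s * (suc k + suc s) ≤⟨ *-monoʳ-≤ (suc s) (+-monoʳ-≤ (suc k) σ≤k+1) ⟩
    suc s * (suc k + suc k) ≡⟨ cong (suc s *_) (2*n≡n+n (suc k)) ⟨
    suc s * (2 * suc k)     ≡⟨ *-comm (suc s) (2 * suc k) ⟩
    2 * suc k * suc s       ≡⟨ *-assoc 2 (suc k) (suc s) ⟩
    2 * (suc k * suc s)     ∎

⌈n/2⌉≤1+⌊n/2⌋ : ∀ n → ⌈ n /2⌉ ≤ suc ⌊ n /2⌋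
⌈n/2⌉≤1+⌊n/2⌋ zero          = z≤n
⌈n/2⌉≤1+⌊n/2⌋ (suc zero)    = s≤s z≤n
⌈n/2⌉≤1+⌊n/2⌋ (suc (suc n)) = s≤s (⌈n/2⌉≤1+⌊n/2⌋ n)

2⌊n/2⌋≤n : ∀ n → 2 * ⌊ n /2⌋ ≤ n
2⌊n/2⌋≤n n =
  subst₂ _≤_ (sym (2*n≡n+n ⌊ n /2⌋)) (⌊n/2⌋+⌈n/2⌉≡n n) (+-monoʳ-≤ ⌊ n /2⌋ (⌊n/2⌋≤⌈n/2⌉ n))

n≤3⌊n/2⌋ : ∀ {n} → 2 ≤ n → n ≤ 3 * ⌊ n /2⌋
n≤3⌊n/2⌋ {n} 2≤n = begin
  n                     ≡⟨ ⌊n/2⌋+⌈n/2⌉≡n n ⟨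
  ⌊ n /2⌋ + ⌈ n /2⌉     ≤⟨ +-monoʳ-≤ ⌊ n /2⌋ (⌈n/2⌉≤1+⌊n/2⌋ n) ⟩
  ⌊ n /2⌋ + suc ⌊ n /2⌋ ≤⟨ +-monoʳ-≤ ⌊ n /2⌋ (+-monoˡ-≤ ⌊ n /2⌋ (⌊n/2⌋-mono 2≤n)) ⟩
  ⌊ n /2⌋ + (⌊ n /2⌋ + ⌊ n /2⌋) ≡⟨ cong (⌊ n /2⌋ +_) (2*n≡n+n ⌊ n /2⌋) ⟨
  3 * ⌊ n /2⌋           ∎
  where open ≤-Reasoning

quadratic-lowerBound : ∀ m → 2 ≤ suc m →
  ∃[ σ ] (σ ≤ suc m × suc m ≤ 3 * σ ×
          Σ (Trie σ m) λ T → ∃[ Es ] (DistinctEdges T Es × suc m * suc m ≤ 6 * length Es))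
quadratic-lowerBound m 2≤n with broom-lowerBound ⌊ suc m /2⌋ m (⌊n/2⌋-mono 2≤n) (2⌊n/2⌋≤n (suc m))
... | T , Es , distinct , σn≤2Es = ⌊ suc m /2⌋ , ⌊n/2⌋≤n (suc m) , n≤3⌊n/2⌋ 2≤n , T , Es , distinct , bound
  where
  open ≤-Reasoning
  bound : suc m * suc m ≤ 6 * length Es
  bound = begin
    suc m * suc m             ≤⟨ *-monoˡ-≤ (suc m) (n≤3⌊n/2⌋ 2≤n) ⟩
    3 * ⌊ suc m /2⌋ * suc m   ≡⟨ *-assoc 3 ⌊ suc m /2⌋ (suc m) ⟩
    3 * (⌊ suc m /2⌋ * suc m) ≤⟨ *-monoʳ-≤ 3 σn≤2Es ⟩
    3 * (2 * length Es)       ≡⟨ *-assoc 3 2 (length Es) ⟨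
    6 * length Es             ∎

theorem9 :
    -- upper bounds: at most 2n-3 nodes, and O(σ n) edges
    ((σ m : ℕ) (T : Trie σ m) → 3 ≤ suc m →
        (Xs : List (Str T)) → DistinctNodes T Xs → length Xs ≤ 2 * suc m ∸ 3)
    × (∃[ c ] ((σ m : ℕ) (T : Trie σ m) → 3 ≤ suc m →
        (Es : List (Str T × Fin σ)) → DistinctEdges T Es → length Es ≤ c * σ * suc m))
    -- lower bound: for σ from Θ(1) up to Θ(n), tries with n nodes whose
    -- CDAWG has Ω(σ n) edges
    × (∃[ c ] ∃[ d ] ∃[ n₀ ] (1 ≤ c × 1 ≤ d ×
        ((σ m : ℕ) → n₀ ≤ suc m → 1 ≤ σ → d * σ ≤ suc m →
          Σ (Trie σ m) λ T → ∃[ Es ] (DistinctEdges T Es × σ * suc m ≤ c * length Es))))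
    -- in particular Ω(n²) edges for some σ = Θ(n)
    × (∃[ c ] ∃[ d ] ∃[ n₀ ] (1 ≤ c × 1 ≤ d ×
        ((m : ℕ) → n₀ ≤ suc m →
          ∃[ σ ] (σ ≤ suc m × suc m ≤ d * σ × Σ (Trie σ m) λ T →
            ∃[ Es ] (DistinctEdges T Es × suc m * suc m ≤ c * length Es)))))
theorem9 = (λ σ m T 3≤n Xs distinct → TrieFacts.nodes-bound T 3≤n Xs distinct)
         , (2 , λ σ m T _ Es distinct → TrieFacts.edges-bound T Es distinct)
         , (2 , 2 , 0 , s≤s z≤n , s≤s z≤n , λ σ m _ → broom-lowerBound σ m)
         , (6 , 3 , 2 , s≤s z≤n , s≤s z≤n , quadratic-lowerBound)
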